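{- $\mathbb{Z}\text{ - }\mathsf{RT}^2\equiv_{\mathrm{sW}}\mathsf{AHT}$, i.e. the $\mathbb Z$-Ramsey's theorem for pairs and the Adjacent Hindman's Theorem are strongly Weihrauch equivalent.
   Context: For a positive integer $k$ we identify $k$ with $\{0,\dots,k-1\}$, and $[\mathbb N]^2$ denotes the set of 2-element subsets of $\mathbb N$. A colouring $c:[\mathbb N]^2\to k$ is $\mathbb Z$-invariant if $c(\{x,y\})=c(\{x+z,y+z\})$ for all $\{x,y\}\in[\mathbb N]^2$ and $z\in\mathbb N$. $\mathbb{Z}\text{ - }\mathsf{RT}^2$ is the problem whose instances are $\mathbb Z$-invariant colourings $c:[\mathbb N]^2\to k$ (any finite $k$) and whose solutions are infinite sets $X\subseteq\mathbb N$ with $[X]^2$ $c$-monochromatic. For an infinite set $X\subseteq\mathbb N$ with increasing enumeration $\langle x_n : n\in\mathbb N\rangle$, let $\mathrm{AFS}(X)=\{x_n+x_{n+1}+\cdots+x_{n+l} : n,l\in\mathbb N\}$. $\mathsf{AHT}$ is the problem whose instances are colourings $c:\mathbb N\to k$ (any finite $k$) and whose solutions are infinite sets $X\subseteq\mathbb N$ such that $\mathrm{AFS}(X)$ is $c$-monochromatic. A problem $P$ is strongly Weihrauch reducible to $Q$ ($P\leq_{\mathrm{sW}}Q$) if there are Turing functionals $\Phi,\Psi$ such that for every instance $X$ of $P$, $\Phi^X$ is an instance of $Q$, and for every solution $Y$ to $\Phi^X$, $\Psi^{Y}$ is a solution to $X$; $P\equiv_{\mathrm{sW}}Q$ means $P\leq_{\mathrm{sW}}Q$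 and $Q\leq_{\mathrm{sW}}P$. -}

module Defs where

open import Data.Nat using (ℕ; zero; suc; _+_; _*_; _∸_; _≤_; _<_; _≡ᵇ_)
open import Data.Bool using (if_then_else_)
open import Data.Fin using (Fin)
open import Data.Vec using (Vec; []; _∷_; lookup)
open import Data.Maybe using (Maybe; just; nothing)
open import Data.Product using (Σ; _×_; ∃-syntax)
open import Relation.Binary.PropositionalEquality using (_≡_)

data Code : ℕ → Set where
  zeroC : ∀ {n} → Code n
  succC : Code 1
  projC : ∀ {n} → Fin n → Code n
  oracC : Code 1
  compC : ∀ {n m} → Code m → Vec (Code n) m → Code n
  recC  : ∀ {n} → Code n → Code (suc (suc n)) → Code (suc n)
  muC   : ∀ {n} → Code (suc n) → Code n

-- Fuel-indexed evaluation (nothing = not (yet) converged).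
mutual
  eval : ℕ → (ℕ → ℕ) → ∀ {n} → Code n → Vec ℕ n → Maybe ℕ
  eval zero    α _           _              = nothing
  eval (suc k) α zeroC       v              = just 0
  eval (suc k) α succC       (x ∷ [])       = just (suc x)
  eval (suc k) α (projC i)   v              = just (lookup v i)
  eval (suc k) α oracC       (x ∷ [])       = just (α x)
  eval (suc k) α (compC f gs) v with evalVec k α gs v
  ... | nothing = nothing
  ... | just w  = eval k α f w
  eval (suc k) α (recC f g)  (zero ∷ v)     = eval k α f v
  eval (suc k) α (recC f g)  (suc x ∷ v) with eval k α (recC f g) (x ∷ v)
  ... | nothing = nothing
  ... | just r  = eval k α g (x ∷ r ∷ v)
  eval (suc k) α (muC f)     v              = search k k α f v 0

  evalVec : ℕ → (ℕ → ℕ) → ∀ {n m} → Vec (Code n) m → Vec ℕ n → Maybe (Vec ℕ m)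
  evalVec k α []       v = just []
  evalVec k α (g ∷ gs) v with eval k α g v | evalVec k α gs v
  ... | just a | just as = just (a ∷ as)
  ... | _      | _       = nothing

  search : ℕ → ℕ → (ℕ → ℕ) → ∀ {n} → Code (suc n) → Vec ℕ n → ℕ → Maybe ℕ
  search k zero      α f v i = nothing
  search k (suc b)   α f v i with eval k α f (i ∷ v)
  ... | nothing      = nothing
  ... | just zero    = just i
  ... | just (suc _) = search k b α f v (suc i)

Computes : Code 1 → (ℕ → ℕ) → (ℕ → ℕ) → Set
Computes Φ α f = ∀ n → ∃[ s ] (eval s α Φ (n ∷ []) ≡ just (f n))

record Problem : Set₁ where
  field
    Inst : (ℕ → ℕ) → Set
    Sol  : (ℕ → ℕ) → (ℕ → ℕ) → Set
open Problem public

_≤sW_ : Problem → Problem → Set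
P ≤sW Q = Σ (Code 1) λ Φ → Σ (Code 1) λ Ψ →
  ∀ x → Inst P x →
    Σ (ℕ → ℕ) λ y → Computes Φ x y × Inst Q y ×
      (∀ z → Sol Q y z → Σ (ℕ → ℕ) λ w → Computes Ψ z w × Sol P x w)

_≡sW_ : Problem → Problem → Set
P ≡sW Q = (P ≤sW Q) × (Q ≤sW P)

tri : ℕ → ℕ
tri zero    = 0
tri (suc n) = suc n + tri n

pair : ℕ → ℕ → ℕ
pair a b = tri (a + b) + b

-- Sets X ⊆ ℕ are named by characteristic functions with values in {0,1}.
IsSetName : (ℕ → ℕ) → Set
IsSetName z = ∀ n → z n ≤ 1

_∈S_ : ℕ → (ℕ → ℕ) → Set
n ∈S z = z n ≡ 1

Infinite : (ℕ → ℕ) → Set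
Infinite z = ∀ n → ∃[ m ] (n ≤ m × m ∈S z)

-- A colouring c : [ℕ]² → k is named by x with x 0 = k and
-- c({a, a+d+1}) = x (suc (pair a d)).
colPair : (ℕ → ℕ) → ℕ → ℕ → ℕ
colPair x a d = x (suc (pair a d))

-- A colouring c : ℕ → k is named by x with x 0 = k and c(n) = x (suc n).
col : (ℕ → ℕ) → ℕ → ℕ
col x n = x (suc n)

ZInvariant : (ℕ → ℕ) → Set
ZInvariant x = ∀ a d z → colPair x a d ≡ colPair x (a + z) d

ZRT2 : Problem
Inst ZRT2 x = (∀ a d → colPair x a d < x 0) × ZInvariant x
Sol  ZRT2 x z = IsSetName z × Infinite z ×
  ∃[ i ] (∀ a d → a ∈S z → (a + suc d) ∈S z → colPair x a d ≡ i)

blockSum : (ℕ → ℕ) → ℕ → ℕ → ℕ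
blockSum z a zero    = if z a ≡ᵇ 1 then a else 0
blockSum z a (suc l) = blockSum z a l + (if z (a + suc l) ≡ᵇ 1 then a + suc l else 0)

-- s ∈ AFS(X): s = x_n + x_{n+1} + ... + x_{n+l}, i.e. the sum of all
-- elements of X between two elements a = x_n ≤ a + l = x_{n+l} of X.
_∈AFS_ : ℕ → (ℕ → ℕ) → Set
s ∈AFS z = ∃[ a ] ∃[ l ] (a ∈S z × (a + l) ∈S z × s ≡ blockSum z a l)

AHT : Problem
Inst AHT x = ∀ n → col x n < x 0
Sol  AHT x z = IsSetName z × Infinite z ×
  ∃[ i ] (∀ s → s ∈AFS z → col x s ≡ i)

-- ℤ-RT² ≤sW AHT: give n the colour c({0, n}). If AFS(X) is homogeneous, so is the set of partial
-- sums x₀ + ⋯ + xₙ of X: the difference of two partial sums is an adjacent sum s, and by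
-- ℤ-invariance c({a, a + s}) = c({0, s}).
-- AHT ≤sW ℤ-RT²: give {a, b} the colour c(b − a), which is ℤ-invariant. In a homogeneous set Y
-- choose y₀ < y₁ < ⋯ with y₍ₖ₊₁₎ > 2yₖ, so that the gaps y₍ₖ₊₁₎ − yₖ increase; an adjacent sum of
-- gaps telescopes to a difference yₘ − yₙ of elements of Y.
-- All maps are primitive recursive apart from two unbounded searches (the next element of Y and
-- unpairing), so each reduction is witnessed by an explicit oracle code.

module Submission where

open import Defs
open import Data.Nat
open import Data.Nat.Properties
open import Data.Fin using (Fin) renaming (zero to fzero; suc to fsuc)
open import Data.Vec using (Vec; []; _∷_; lookup)
open import Data.Maybe using (just; nothing)
open import Data.Product
open import Data.Empty using (⊥-elim)
open import Data.Sum using (_⊎_; inj₁; inj₂)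
open import Relation.Nullary using (yes; no)
open import Relation.Binary.Definitions using (tri<; tri≈; tri>)
open import Relation.Binary.PropositionalEquality

nothing≢just : ∀ {A : Set} {a : A} → nothing ≢ just a
nothing≢just ()

suc-closed⇒≤-closed : (P : ℕ → Set) → (∀ k → P k → P (suc k)) → ∀ {k k′} → k ≤ k′ → P k → P k′
suc-closed⇒≤-closed P step k≤k′ = go (≤⇒≤′ k≤k′)
  where
  go : ∀ {k k′} → k ≤′ k′ → P k → P k′
  go ≤′-refl        p = p
  go (≤′-step k≤′n) p = step _ (go k≤′n p)

mutual
  eval-suc : ∀ k α {n} (c : Code n) v r → eval k α c v ≡ just r → eval (suc k) α c v ≡ just r
  eval-suc zero α c v r ()
  eval-suc (suc k) α zeroC v r e = e
  eval-suc (suc k) α succC (x ∷ []) r e = e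
  eval-suc (suc k) α (projC i) v r e = e
  eval-suc (suc k) α oracC (x ∷ []) r e = e
  eval-suc (suc k) α (compC f gs) v r e with evalVec k α gs v in eq
  ... | nothing = ⊥-elim (nothing≢just e)
  ... | just w rewrite evalVec-suc k α gs v w eq = eval-suc k α f w r e
  eval-suc (suc k) α (recC f g) (zero ∷ v) r e = eval-suc k α f v r e
  eval-suc (suc k) α (recC f g) (suc x ∷ v) r e with eval k α (recC f g) (x ∷ v) in eq
  ... | nothing = ⊥-elim (nothing≢just e)
  ... | just q rewrite eval-suc k α (recC f g) (x ∷ v) q eq = eval-suc k α g (x ∷ q ∷ v) r e
  eval-suc (suc k) α (muC f) v r e = search-suc k k α f v 0 r e

  evalVec-suc : ∀ k α {n m} (gs : Vec (Code n) m) v w → evalVec k α gs v ≡ just w → evalVec (suc k) α gs v ≡ just w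
  evalVec-suc k α [] v w e = e
  evalVec-suc k α (g ∷ gs) v w e with eval k α g v in e₁ | evalVec k α gs v in e₂
  ... | just a  | just as rewrite eval-suc k α g v a e₁ | evalVec-suc k α gs v as e₂ = e
  ... | just a  | nothing = ⊥-elim (nothing≢just e)
  ... | nothing | _       = ⊥-elim (nothing≢just e)

  search-suc : ∀ k b α {n} (f : Code (suc n)) v i r → search k b α f v i ≡ just r → search (suc k) (suc b) α f v i ≡ just r
  search-suc k zero α f v i r ()
  search-suc k (suc b) α f v i r e with eval k α f (i ∷ v) in e₁
  ... | nothing = ⊥-elim (nothing≢just e)
  ... | just zero    rewrite eval-suc k α f (i ∷ v) 0 e₁       = e
  ... | just (suc q) rewrite eval-suc k α f (i ∷ v) (suc q) e₁ = search-suc k b α f v (suc i) r e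

eval-mono : ∀ α {n} (c : Code n) v r {k k′} → k ≤ k′ → eval k α c v ≡ just r → eval k′ α c v ≡ just r
eval-mono α c v r = suc-closed⇒≤-closed (λ k → eval k α c v ≡ just r) (λ k → eval-suc k α c v r)

evalVec-mono : ∀ α {n m} (gs : Vec (Code n) m) v w {k k′} → k ≤ k′ → evalVec k α gs v ≡ just w → evalVec k′ α gs v ≡ just w
evalVec-mono α gs v w = suc-closed⇒≤-closed (λ k → evalVec k α gs v ≡ just w) (λ k → evalVec-suc k α gs v w)

record Realises (α : ℕ → ℕ) {n} (c : Code n) (f : Vec ℕ n → ℕ) : Set where
  constructor realises
  field converges : ∀ v → ∃[ s ] eval s α c v ≡ just (f v)
open Realises

record RealisesVec (α : ℕ → ℕ) {n m} (gs : Vec (Code n) m) (fs : Vec ℕ n → Vec ℕ m) : Set where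
  constructor realisesVec
  field convergesVec : ∀ v → ∃[ s ] evalVec s α gs v ≡ just (fs v)
open RealisesVec

realises⇒computes : ∀ {α Φ f} → Realises α Φ (λ v → f (lookup v fzero)) → Computes Φ α f
realises⇒computes r n = converges r (n ∷ [])

primRec : ∀ {n} → (Vec ℕ n → ℕ) → (Vec ℕ (suc (suc n)) → ℕ) → Vec ℕ (suc n) → ℕ
primRec f g (zero  ∷ v) = f v
primRec f g (suc x ∷ v) = g (x ∷ primRec f g (x ∷ v) ∷ v)

primRec-unique : ∀ {n} f g (h : Vec ℕ (suc n) → ℕ) → (∀ v → h (0 ∷ v) ≡ f v) →
  (∀ x v → h (suc x ∷ v) ≡ g (x ∷ h (x ∷ v) ∷ v)) → ∀ v → primRec f g v ≡ h v
primRec-unique f g h h0 hs (zero  ∷ v) = sym (h0 v)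
primRec-unique f g h h0 hs (suc x ∷ v) = trans (cong (λ r → g (x ∷ r ∷ v)) (primRec-unique f g h h0 hs (x ∷ v))) (sym (hs x v))

module _ {α : ℕ → ℕ} where

  Realises-ext : ∀ {n} {c : Code n} {f g} → Realises α c f → (∀ v → f v ≡ g v) → Realises α c g
  Realises-ext rf f≗g = realises λ v → proj₁ (converges rf v) , trans (proj₂ (converges rf v)) (cong just (f≗g v))

  zeroᴿ : ∀ {n} → Realises α (zeroC {n}) (λ _ → 0)
  zeroᴿ = realises λ v → 1 , refl

  succᴿ : Realises α succC (λ v → suc (lookup v fzero))
  succᴿ = realises λ { (x ∷ []) → 1 , refl }

  projᴿ : ∀ {n} (i : Fin n) → Realises α (projC i) (λ v → lookup v i)
  projᴿ i = realises λ v → 1 , refl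

  oracleᴿ : Realises α oracC (λ v → α (lookup v fzero))
  oracleᴿ = realises λ { (x ∷ []) → 1 , refl }

  []ᴿ : ∀ {n} → RealisesVec α {n} [] (λ _ → [])
  []ᴿ = realisesVec λ v → 0 , refl

  _∷ᴿ_ : ∀ {n m} {g : Code n} {gs : Vec (Code n) m} {f fs} → Realises α g f → RealisesVec α gs fs →
    RealisesVec α (g ∷ gs) (λ v → f v ∷ fs v)
  _∷ᴿ_ {g = g} {gs} {f} {fs} rg rgs = realisesVec converge
    where
    converge : ∀ v → ∃[ s ] evalVec s α (g ∷ gs) v ≡ just (f v ∷ fs v)
    converge v with converges rg v | convergesVec rgs v
    ... | s₁ , e₁ | s₂ , e₂ = s₁ ⊔ s₂ , goal
      where
      goal : evalVec (s₁ ⊔ s₂) α (g ∷ gs) v ≡ just (f v ∷ fs v)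
      goal rewrite eval-mono α g v (f v) (m≤m⊔n s₁ s₂) e₁ | evalVec-mono α gs v (fs v) (m≤n⊔m s₁ s₂) e₂ = refl

  compᴿ : ∀ {n m} {f : Code m} {gs : Vec (Code n) m} {F G} → Realises α f F → RealisesVec α gs G →
    Realises α (compC f gs) (λ v → F (G v))
  compᴿ {f = f} {gs} {F} {G} rf rgs = realises converge
    where
    converge : ∀ v → ∃[ s ] eval s α (compC f gs) v ≡ just (F (G v))
    converge v with convergesVec rgs v | converges rf (G v)
    ... | s₁ , e₁ | s₂ , e₂ = suc (s₁ ⊔ s₂) , goal
      where
      goal : eval (suc (s₁ ⊔ s₂)) α (compC f gs) v ≡ just (F (G v))
      goal rewrite evalVec-mono α gs v (G v) (m≤m⊔n s₁ s₂) e₁ = eval-mono α f (G v) (F (G v)) (m≤n⊔m s₁ s₂) e₂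

  primRecᴿ : ∀ {n} {f : Code n} {g : Code (suc (suc n))} {F G} → Realises α f F → Realises α g G →
    Realises α (recC f g) (primRec F G)
  primRecᴿ {f = f} {g} {F} {G} rf rg = realises converge
    where
    converge : ∀ v → ∃[ s ] eval s α (recC f g) v ≡ just (primRec F G v)
    converge (zero ∷ v) with converges rf v
    ... | s , e = suc s , e
    converge (suc x ∷ v) with converge (x ∷ v) | converges rg (x ∷ primRec F G (x ∷ v) ∷ v)
    ... | s₁ , e₁ | s₂ , e₂ = suc (s₁ ⊔ s₂) , goal
      where
      goal : eval (suc (s₁ ⊔ s₂)) α (recC f g) (suc x ∷ v) ≡ just (primRec F G (suc x ∷ v))
      goal rewrite eval-mono α (recC f g) (x ∷ v) _ (m≤m⊔n s₁ s₂) e₁ = eval-mono α g _ _ (m≤n⊔m s₁ s₂) e₂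

  recᴿ : ∀ {n} {f : Code n} {g : Code (suc (suc n))} {F G} → Realises α f F → Realises α g G →
    (h : Vec ℕ (suc n) → ℕ) → (∀ v → h (0 ∷ v) ≡ F v) → (∀ x v → h (suc x ∷ v) ≡ G (x ∷ h (x ∷ v) ∷ v)) →
    Realises α (recC f g) h
  recᴿ {F = F} {G} rf rg h h0 hs = Realises-ext (primRecᴿ rf rg) (primRec-unique F G h h0 hs)

IsLeastZero : (ℕ → ℕ) → ℕ → Set
IsLeastZero F j = F j ≡ 0 × (∀ m → m < j → F m ≢ 0)

leastZero-below : ∀ F n → (∃[ j ] (j < n × IsLeastZero F j)) ⊎ (∀ m → m < n → F m ≢ 0)
leastZero-below F zero = inj₂ (λ m ())
leastZero-below F (suc n) with leastZero-below F n
... | inj₁ (j , j<n , least) = inj₁ (j , m<n⇒m<1+n j<n , least)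
... | inj₂ none with F n in eq
...   | zero  = inj₁ (n , n<1+n n , eq , none)
...   | suc _ = inj₂ none′
  where
  none′ : ∀ m → m < suc n → F m ≢ 0
  none′ m m<1+n with m≤n⇒m<n∨m≡n (≤-pred m<1+n)
  ... | inj₁ m<n  = none m m<n
  ... | inj₂ refl = λ e → 0≢1+n (trans (sym e) eq)

leastZero : ∀ F i → F i ≡ 0 → ∃ (IsLeastZero F)
leastZero F i Fi≡0 with leastZero-below F (suc i)
... | inj₁ (j , _ , least) = j , least
... | inj₂ none            = ⊥-elim (none i (n<1+n i) Fi≡0)

IsLeastZero-unique : ∀ {F j j′} → IsLeastZero F j → IsLeastZero F j′ → j ≡ j′
IsLeastZero-unique {j = j} {j′} (e , below) (e′ , below′) with <-cmp j j′
... | tri< j<j′ _ _ = ⊥-elim (below′ j j<j′ e)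
... | tri≈ _ j≡j′ _ = j≡j′
... | tri> _ _ j′<j = ⊥-elim (below j′ j′<j e′)

module _ {α : ℕ → ℕ} where

  fuel-upTo : ∀ {n} {f : Code (suc n)} {F} → Realises α f F → ∀ v i →
    ∃[ k ] (i < k × ∀ m → m ≤ i → eval k α f (m ∷ v) ≡ just (F (m ∷ v)))
  fuel-upTo {f = f} rf v zero with converges rf (0 ∷ v)
  ... | s , e = suc s , s≤s z≤n , λ { zero _ → eval-mono α f _ _ (n≤1+n s) e }
  fuel-upTo {f = f} {F} rf v (suc i) with fuel-upTo rf v i | converges rf (suc i ∷ v)
  ... | k , i<k , below | s , e = suc (k ⊔ s) , s≤s (≤-trans i<k (m≤m⊔n k s)) , upTo
    where
    upTo : ∀ m → m ≤ suc i → eval (suc (k ⊔ s)) α f (m ∷ v) ≡ just (F (m ∷ v))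
    upTo m m≤1+i with m≤n⇒m<n∨m≡n m≤1+i
    ... | inj₁ m<1+i = eval-mono α f _ _ (m≤n⇒m≤1+n (m≤m⊔n k s)) (below m (≤-pred m<1+i))
    ... | inj₂ refl  = eval-mono α f _ _ (m≤n⇒m≤1+n (m≤n⊔m k s)) e

  search-least : ∀ {n} (f : Code (suc n)) (F : Vec ℕ (suc n) → ℕ) k v i →
    (∀ m → m ≤ i → eval k α f (m ∷ v) ≡ just (F (m ∷ v))) → IsLeastZero (λ m → F (m ∷ v)) i →
    ∀ b j → j ≤ i → i < j + b → search k b α f v j ≡ just i
  search-least f F k v i evals least zero j j≤i i<j+0 =
    ⊥-elim (<⇒≱ (subst (i <_) (+-identityʳ j) i<j+0) j≤i)
  search-least f F k v i evals (Fi≡0 , below) (suc b) j j≤i i<j+b rewrite evals j j≤i with F (j ∷ v) in eq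
  ... | zero with m≤n⇒m<n∨m≡n j≤i
  ...   | inj₁ j<i  = ⊥-elim (below j j<i eq)
  ...   | inj₂ refl = refl
  search-least f F k v i evals (Fi≡0 , below) (suc b) j j≤i i<j+b | suc _ with m≤n⇒m<n∨m≡n j≤i
  ...   | inj₂ refl = ⊥-elim (0≢1+n (trans (sym Fi≡0) eq))
  ...   | inj₁ j<i  = search-least f F k v i evals (Fi≡0 , below) b (suc j) j<i (subst (i <_) (+-suc j b) i<j+b)

  muᴿ : ∀ {n} {f : Code (suc n)} {F} → Realises α f F →
    (G : Vec ℕ n → ℕ) → (∀ v → IsLeastZero (λ m → F (m ∷ v)) (G v)) → Realises α (muC f) G
  muᴿ {f = f} {F} rf G least = realises converge
    where
    converge : ∀ v → ∃[ s ] eval s α (muC f) v ≡ just (G v)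
    converge v with fuel-upTo rf v (G v)
    ... | k , G<k , evals = suc k , search-least f F k v (G v) evals (least v) k 0 z≤n G<k

arg₀ : ∀ {n} → Vec ℕ (suc n) → ℕ
arg₀ v = lookup v fzero

arg₁ : ∀ {n} → Vec ℕ (suc (suc n)) → ℕ
arg₁ v = lookup v (fsuc fzero)

arg₂ : ∀ {n} → Vec ℕ (suc (suc (suc n))) → ℕ
arg₂ v = lookup v (fsuc (fsuc fzero))

π₀ : ∀ {n} → Code (suc n)
π₀ = projC fzero

π₁ : ∀ {n} → Code (suc (suc n))
π₁ = projC (fsuc fzero)

π₂ : ∀ {n} → Code (suc (suc (suc n)))
π₂ = projC (fsuc (fsuc fzero))

app₁ : ∀ {n} → Code 1 → Code n → Code n
app₁ f g = compC f (g ∷ [])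

app₂ : ∀ {n} → Code 2 → Code n → Code n → Code n
app₂ f g h = compC f (g ∷ h ∷ [])

isZero : ℕ → ℕ
isZero zero    = 1
isZero (suc _) = 0

eqInd : ℕ → ℕ → ℕ
eqInd x y = isZero ((y ∸ x) + (x ∸ y))

eqInd-refl : ∀ x → eqInd x x ≡ 1
eqInd-refl x rewrite n∸n≡0 x = refl

eqInd≢0⇒≡ : ∀ x y → eqInd x y ≢ 0 → x ≡ y
eqInd≢0⇒≡ x y ≢0 with (y ∸ x) + (x ∸ y) in eq
... | suc _ = ⊥-elim (≢0 refl)
... | zero  = ≤-antisym (m∸n≡0⇒m≤n (m+n≡0⇒n≡0 (y ∸ x) eq)) (m∸n≡0⇒m≤n (m+n≡0⇒m≡0 (y ∸ x) eq))

oneC : ∀ {n} → Code n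
oneC = app₁ succC zeroC

addC : Code 2
addC = recC π₀ (app₁ succC π₁)

predC : Code 1
predC = recC zeroC π₀

monusC : Code 2
monusC = recC π₀ (app₁ predC π₁)

mulC : Code 2
mulC = recC zeroC (app₂ addC π₁ π₂)

isZeroC : Code 1
isZeroC = recC oneC zeroC

triC : Code 1
triC = recC zeroC (app₂ addC (app₁ succC π₀) π₁)

eqC : Code 2
eqC = app₁ isZeroC (app₂ addC (app₂ monusC π₀ π₁) (app₂ monusC π₁ π₀))

module _ {α : ℕ → ℕ} where

  app₁ᴿ : ∀ {n} {f : Code 1} {g : Code n} {F G} → Realises α f F → Realises α g G →
    Realises α (app₁ f g) (λ v → F (G v ∷ []))
  app₁ᴿ rf rg = compᴿ rf (rg ∷ᴿ []ᴿ)

  app₂ᴿ : ∀ {n} {f : Code 2} {g h : Code n} {F G H} → Realises α f F → Realises α g G → Realises α h H →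
    Realises α (app₂ f g h) (λ v → F (G v ∷ H v ∷ []))
  app₂ᴿ rf rg rh = compᴿ rf (rg ∷ᴿ (rh ∷ᴿ []ᴿ))

  π₀ᴿ : ∀ {n} → Realises α (π₀ {n}) arg₀
  π₀ᴿ = projᴿ fzero

  π₁ᴿ : ∀ {n} → Realises α (π₁ {n}) arg₁
  π₁ᴿ = projᴿ (fsuc fzero)

  π₂ᴿ : ∀ {n} → Realises α (π₂ {n}) arg₂
  π₂ᴿ = projᴿ (fsuc (fsuc fzero))

  oneᴿ : ∀ {n} → Realises α (oneC {n}) (λ _ → 1)
  oneᴿ = app₁ᴿ succᴿ zeroᴿ

  addᴿ : Realises α addC (λ v → arg₀ v + arg₁ v)
  addᴿ = recᴿ π₀ᴿ (app₁ᴿ succᴿ π₁ᴿ) _ (λ { (y ∷ []) → refl }) (λ { x (y ∷ []) → refl })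

  predᴿ : Realises α predC (λ v → pred (arg₀ v))
  predᴿ = recᴿ zeroᴿ π₀ᴿ _ (λ { [] → refl }) (λ { x [] → refl })

  monusᴿ : Realises α monusC (λ v → arg₁ v ∸ arg₀ v)
  monusᴿ = recᴿ π₀ᴿ (app₁ᴿ predᴿ π₁ᴿ) _ (λ { (y ∷ []) → refl }) (λ { x (y ∷ []) → sym (pred[m∸n]≡m∸[1+n] y x) })

  mulᴿ : Realises α mulC (λ v → arg₀ v * arg₁ v)
  mulᴿ = recᴿ zeroᴿ (app₂ᴿ addᴿ π₁ᴿ π₂ᴿ) _ (λ { (y ∷ []) → refl }) (λ { x (y ∷ []) → +-comm y (x * y) })

  isZeroᴿ : Realises α isZeroC (λ v → isZero (arg₀ v))
  isZeroᴿ = recᴿ oneᴿ zeroᴿ _ (λ { [] → refl }) (λ { x [] → refl })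

  triᴿ : Realises α triC (λ v → tri (arg₀ v))
  triᴿ = recᴿ zeroᴿ (app₂ᴿ addᴿ (app₁ᴿ succᴿ π₀ᴿ) π₁ᴿ) _ (λ { [] → refl }) (λ { x [] → refl })

  eqᴿ : Realises α eqC (λ v → eqInd (arg₀ v) (arg₁ v))
  eqᴿ = app₁ᴿ isZeroᴿ (app₂ᴿ addᴿ (app₂ᴿ monusᴿ π₀ᴿ π₁ᴿ) (app₂ᴿ monusᴿ π₁ᴿ π₀ᴿ))

sumUpTo : (ℕ → ℕ) → ℕ → ℕ
sumUpTo P zero    = P 0
sumUpTo P (suc m) = sumUpTo P m + P (suc m)

sumUpTo≢0 : ∀ P m j → j ≤ m → P j ≢ 0 → sumUpTo P m ≢ 0
sumUpTo≢0 P zero    .zero z≤n Pj≢0 = Pj≢0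
sumUpTo≢0 P (suc m) j j≤1+m Pj≢0 sum≡0 with m≤n⇒m<n∨m≡n j≤1+m
... | inj₁ j<1+m = sumUpTo≢0 P m j (≤-pred j<1+m) Pj≢0 (m+n≡0⇒m≡0 (sumUpTo P m) sum≡0)
... | inj₂ refl  = Pj≢0 (m+n≡0⇒n≡0 (sumUpTo P m) sum≡0)

sumUpTo≢0⇒∃ : ∀ P m → sumUpTo P m ≢ 0 → ∃[ j ] (j ≤ m × P j ≢ 0)
sumUpTo≢0⇒∃ P zero    sum≢0 = 0 , z≤n , sum≢0
sumUpTo≢0⇒∃ P (suc m) sum≢0 with P (suc m) in eq
... | suc _ = suc m , ≤-refl , λ e → 0≢1+n (trans (sym e) eq)
... | zero with sumUpTo≢0⇒∃ P m (λ e → sum≢0 (trans (+-identityʳ (sumUpTo P m)) e))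
...   | j , j≤m , Pj≢0 = j , m≤n⇒m≤1+n j≤m , Pj≢0

isPositive : ℕ → ℕ
isPositive n = isZero (isZero n)

existsUpTo : (ℕ → ℕ → ℕ) → ℕ → ℕ
existsUpTo P n = isPositive (sumUpTo (λ j → P j n) n)

existsUpTo≤1 : ∀ P n → existsUpTo P n ≤ 1
existsUpTo≤1 P n with sumUpTo (λ j → P j n) n
... | zero  = z≤n
... | suc _ = ≤-refl

existsUpTo-intro : ∀ P n j → j ≤ n → P j n ≢ 0 → existsUpTo P n ≡ 1
existsUpTo-intro P n j j≤n Pjn≢0 with sumUpTo (λ j → P j n) n | sumUpTo≢0 (λ j → P j n) n j j≤n Pjn≢0
... | zero  | sum≢0 = ⊥-elim (sum≢0 refl)
... | suc _ | _     = refl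

existsUpTo-elim : ∀ P n → existsUpTo P n ≡ 1 → ∃[ j ] (j ≤ n × P j n ≢ 0)
existsUpTo-elim P n e = sumUpTo≢0⇒∃ (λ j → P j n) n sum≢0
  where
  sum≢0 : sumUpTo (λ j → P j n) n ≢ 0
  sum≢0 sum≡0 with sumUpTo (λ j → P j n) n
  sum≢0 refl | zero = 0≢1+n e

countC : Code 2 → Code 2
countC p = recC (app₂ p zeroC π₀) (app₂ addC π₁ (app₂ p (app₁ succC π₀) π₂))

existsUpToC : Code 2 → Code 1
existsUpToC p = app₁ isZeroC (app₁ isZeroC (app₂ (countC p) π₀ π₀))

existsUpToᴿ : ∀ {α p} {P : ℕ → ℕ → ℕ} → Realises α p (λ v → P (arg₀ v) (arg₁ v)) →
  Realises α (existsUpToC p) (λ v → existsUpTo P (arg₀ v))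
existsUpToᴿ {α} {p} {P} rp = app₁ᴿ isZeroᴿ (app₁ᴿ isZeroᴿ (app₂ᴿ countᴿ π₀ᴿ π₀ᴿ))
  where
  countᴿ : Realises α (countC p) (λ v → sumUpTo (λ j → P j (arg₁ v)) (arg₀ v))
  countᴿ = recᴿ (app₂ᴿ rp zeroᴿ π₀ᴿ) (app₂ᴿ addᴿ π₁ᴿ (app₂ᴿ rp (app₁ᴿ succᴿ π₀ᴿ) π₂ᴿ)) _
             (λ { (n ∷ []) → refl }) (λ { x (n ∷ []) → refl })

blockSum-single-∈ : ∀ z j → z j ≡ 1 → blockSum z j 0 ≡ j
blockSum-single-∈ z j zj≡1 rewrite zj≡1 = refl

blockSum-single-∉ : ∀ z j → z j ≢ 1 → blockSum z j 0 ≡ 0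
blockSum-single-∉ z j zj≢1 with z j
... | zero        = refl
... | suc zero    = ⊥-elim (zj≢1 refl)
... | suc (suc _) = refl

blockSum-split : ∀ z a l r → blockSum z a (suc (l + r)) ≡ blockSum z a l + blockSum z (suc (a + l)) r
blockSum-split z a l zero rewrite +-identityʳ l | +-suc a l = refl
blockSum-split z a l (suc r)
  rewrite +-suc l r | blockSum-split z a l r | +-suc a (suc (l + r)) | +-assoc a l (suc r) | +-suc l r =
  +-assoc (blockSum z a l) (blockSum z (suc (a + l)) r) _

blockSum-skip : ∀ z a p r → (∀ j → j < p → z (a + j) ≢ 1) → blockSum z a (p + r) ≡ blockSum z (a + p) r
blockSum-skip z a zero    r _ rewrite +-identityʳ a = refl
blockSum-skip z a (suc p) r outside = begin
    blockSum z a (suc (p + r))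
  ≡⟨ blockSum-split z a 0 (p + r) ⟩
    blockSum z a 0 + blockSum z (suc (a + 0)) (p + r)
  ≡⟨ cong₂ _+_ (blockSum-single-∉ z a a∉) (cong (λ t → blockSum z (suc t) (p + r)) (+-identityʳ a)) ⟩
    blockSum z (suc a) (p + r)
  ≡⟨ blockSum-skip z (suc a) p r (λ j j<p → subst (λ t → z t ≢ 1) (+-suc a j) (outside (suc j) (s≤s j<p))) ⟩
    blockSum z (suc a + p) r
  ≡⟨ cong (λ t → blockSum z t r) (sym (+-suc a p)) ⟩
    blockSum z (a + suc p) r
  ∎
  where
  open ≡-Reasoning
  a∉ : z a ≢ 1
  a∉ = subst (λ t → z t ≢ 1) (+-identityʳ a) (outside 0 (s≤s z≤n))

stepwise-mono : (f : ℕ → ℕ) → (∀ n → f n ≤ f (suc n)) → ∀ {m n} → m ≤ n → f m ≤ f n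
stepwise-mono f step {m} m≤n = suc-closed⇒≤-closed (λ n → f m ≤ f n) (λ n fm≤fn → ≤-trans fm≤fn (step n)) m≤n ≤-refl

module StrictlyIncreasing (f : ℕ → ℕ) (step : ∀ n → f n < f (suc n)) where

  mono-≤ : ∀ {m n} → m ≤ n → f m ≤ f n
  mono-≤ = stepwise-mono f (λ n → <⇒≤ (step n))

  mono-< : ∀ {m n} → m < n → f m < f n
  mono-< {n = suc n} (s≤s m≤n) = ≤-<-trans (mono-≤ m≤n) (step n)

  cancel-≤ : ∀ {m n} → f m ≤ f n → m ≤ n
  cancel-≤ {m} {n} fm≤fn with m ≤? n
  ... | yes m≤n = m≤n
  ... | no  m≰n = ⊥-elim (<⇒≱ (mono-< (≰⇒> m≰n)) fm≤fn)

  cancel-< : ∀ {m n} → f m < f n → m < n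
  cancel-< {m} {n} fm<fn with m <? n
  ... | yes m<n = m<n
  ... | no  m≮n = ⊥-elim (<⇒≱ fm<fn (mono-≤ (≮⇒≥ m≮n)))

sumFrom : (ℕ → ℕ) → ℕ → ℕ → ℕ
sumFrom f n zero    = f n
sumFrom f n (suc q) = sumFrom f n q + f (suc (n + q))

∸-telescope : ∀ {a b c} → a ≤ b → b ≤ c → (b ∸ a) + (c ∸ b) ≡ c ∸ a
∸-telescope {a} {b} {c} a≤b b≤c = begin
    (b ∸ a) + (c ∸ b)
  ≡⟨ +-comm (b ∸ a) (c ∸ b) ⟩
    (c ∸ b) + (b ∸ a)
  ≡⟨ +-∸-assoc (c ∸ b) a≤b ⟨
    ((c ∸ b) + b) ∸ a
  ≡⟨ cong (_∸ a) (m∸n+n≡m b≤c) ⟩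
    c ∸ a
  ∎
  where open ≡-Reasoning

∸-split : ∀ {a b c} → a ≤ b → b < c → c ∸ a ≡ suc ((b ∸ a) + (c ∸ suc b))
∸-split {a} {b} {c} a≤b b<c = begin
    c ∸ a
  ≡⟨ cong (_∸ a) (m+[n∸m]≡n b<c) ⟨
    (suc b + (c ∸ suc b)) ∸ a
  ≡⟨ cong (λ u → (suc u + (c ∸ suc b)) ∸ a) (m+[n∸m]≡n a≤b) ⟨
    (suc (a + (b ∸ a)) + (c ∸ suc b)) ∸ a
  ≡⟨ cong (λ u → suc u ∸ a) (+-assoc a (b ∸ a) (c ∸ suc b)) ⟩
    suc (a + ((b ∸ a) + (c ∸ suc b))) ∸ a
  ≡⟨ cong (_∸ a) (+-suc a ((b ∸ a) + (c ∸ suc b))) ⟨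
    (a + suc ((b ∸ a) + (c ∸ suc b))) ∸ a
  ≡⟨ m+n∸m≡n a _ ⟩
    suc ((b ∸ a) + (c ∸ suc b))
  ∎
  where open ≡-Reasoning

sumFrom-differences : ∀ (g : ℕ → ℕ) → (∀ k → g k ≤ g (suc k)) → ∀ n q → sumFrom (λ k → g (suc k) ∸ g k) n q ≡ g (suc (n + q)) ∸ g n
sumFrom-differences g step n zero rewrite +-identityʳ n = refl
sumFrom-differences g step n (suc q) rewrite sumFrom-differences g step n q | +-suc n q =
  ∸-telescope (stepwise-mono g step (m≤n⇒m≤1+n (m≤m+n n q))) (step (suc (n + q)))

module EnumeratedSet (f : ℕ → ℕ) (step : ∀ n → f n < f (suc n)) (w : ℕ → ℕ)
                     (f∈w : ∀ k → w (f k) ≡ 1) (w⊆f : ∀ j → w j ≡ 1 → ∃[ k ] f k ≡ j) where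
  open StrictlyIncreasing f step

  between-∉ : ∀ k j → f k < j → j < f (suc k) → w j ≢ 1
  between-∉ k j lo hi wj≡1 with w⊆f j wj≡1
  ... | k′ , refl = <⇒≱ (cancel-< lo) (≤-pred (cancel-< hi))

  blockSum-range : ∀ n q → blockSum w (f n) (f (n + q) ∸ f n) ≡ sumFrom f n q
  blockSum-range n zero rewrite +-identityʳ n | n∸n≡0 (f n) = blockSum-single-∈ w (f n) (f∈w n)
  blockSum-range n (suc q) rewrite +-suc n q = begin
      blockSum w A (C ∸ A)
    ≡⟨ cong (blockSum w A) (∸-split (mono-≤ (m≤m+n n q)) (step (n + q))) ⟩
      blockSum w A (suc (L + R))
    ≡⟨ blockSum-split w A L R ⟩
      blockSum w A L + blockSum w (suc (A + L)) R
    ≡⟨ cong₂ _+_ (blockSum-range n q) (cong (λ u → blockSum w (suc u) R) A+L≡B) ⟩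
      sumFrom f n q + blockSum w (suc B) R
    ≡⟨ cong (sumFrom f n q +_) (trans (cong (blockSum w (suc B)) (sym (+-identityʳ R))) (blockSum-skip w (suc B) R 0 skipped)) ⟩
      sumFrom f n q + blockSum w (suc B + R) 0
    ≡⟨ cong (λ u → sumFrom f n q + blockSum w u 0) 1+B+R≡C ⟩
      sumFrom f n q + blockSum w C 0
    ≡⟨ cong (sumFrom f n q +_) (blockSum-single-∈ w C (f∈w (suc (n + q)))) ⟩
      sumFrom f n q + C
    ∎
    where
    open ≡-Reasoning
    A B C L R : ℕ
    A = f n
    B = f (n + q)
    C = f (suc (n + q))
    L = B ∸ A
    R = C ∸ suc B
    A+L≡B : A + L ≡ B
    A+L≡B = m+[n∸m]≡n (mono-≤ (m≤m+n n q))
    1+B+R≡C : suc B + R ≡ C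
    1+B+R≡C = m+[n∸m]≡n (step (n + q))
    skipped : ∀ j → j < R → w (suc B + j) ≢ 1
    skipped j j<R = between-∉ (n + q) (suc B + j) (s≤s (m≤m+n B j)) (subst (suc B + j <_) 1+B+R≡C (+-monoʳ-< (suc B) j<R))

  AFS⇒sumFrom : ∀ s → s ∈AFS w → ∃[ n ] ∃[ q ] s ≡ sumFrom f n q
  AFS⇒sumFrom s (a , l , a∈ , a+l∈ , s≡) with w⊆f a a∈
  ... | n , refl with w⊆f (f n + l) a+l∈
  ...   | m , fm≡ = n , m ∸ n , trans s≡ (trans (cong (blockSum w (f n)) (sym l≡)) (blockSum-range n (m ∸ n)))
    where
    n+[m∸n]≡m : n + (m ∸ n) ≡ m
    n+[m∸n]≡m = m+[n∸m]≡n (cancel-≤ (subst (f n ≤_) (sym fm≡) (m≤m+n (f n) l)))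
    l≡ : f (n + (m ∸ n)) ∸ f n ≡ l
    l≡ = trans (cong (λ k → f k ∸ f n) n+[m∸n]≡m) (trans (cong (_∸ f n) fm≡) (m+n∸m≡n (f n) l))

-- ℤ-RT² reduces to AHT

-- Entry 0 of a name is the number of colours; n = 0 receives the junk colour c({0, 1}).
colourFromZero : (ℕ → ℕ) → ℕ → ℕ
colourFromZero x zero    = x 0
colourFromZero x (suc n) = colPair x 0 (pred n)

colourFromZeroC : Code 1
colourFromZeroC = recC (app₁ oracC zeroC)
  (app₁ oracC (app₁ succC (app₂ addC (app₁ triC (app₁ predC π₀)) (app₁ predC π₀))))

colourFromZeroᴿ : ∀ {x} → Realises x colourFromZeroC (λ v → colourFromZero x (arg₀ v))
colourFromZeroᴿ = recᴿ (app₁ᴿ oracleᴿ zeroᴿ)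
  (app₁ᴿ oracleᴿ (app₁ᴿ succᴿ (app₂ᴿ addᴿ (app₁ᴿ triᴿ (app₁ᴿ predᴿ π₀ᴿ)) (app₁ᴿ predᴿ π₀ᴿ)))) _
  (λ { [] → refl }) (λ { x [] → refl })

blockSum-single-eqInd : ∀ z j → blockSum z j 0 ≡ eqInd (z j) 1 * j
blockSum-single-eqInd z j with z j
... | zero        = refl
... | suc zero    = sym (+-identityʳ j)
... | suc (suc _) = refl

nextMember : ∀ (z : ℕ → ℕ) a r → z (a + r) ≡ 1 → ∃[ j ] (j ≤ r × z (a + j) ≡ 1 × ∀ i → i < j → z (a + i) ≢ 1)
nextMember z a r z[a+r]≡1 with z (a + 0) ≟ 1
... | yes z[a+0]≡1 = 0 , z≤n , z[a+0]≡1 , λ i ()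
nextMember z a zero    z[a+r]≡1 | no z[a+0]≢1 = ⊥-elim (z[a+0]≢1 z[a+r]≡1)
nextMember z a (suc r) z[a+r]≡1 | no z[a+0]≢1
  with nextMember z (suc a) r (subst (λ t → z t ≡ 1) (+-suc a r) z[a+r]≡1)
... | j , j≤r , z[1+a+j]≡1 , skipped = suc j , s≤s j≤r , subst (λ t → z t ≡ 1) (sym (+-suc a j)) z[1+a+j]≡1 , skipped′
  where
  skipped′ : ∀ i → i < suc j → z (a + i) ≢ 1
  skipped′ zero    _         = z[a+0]≢1
  skipped′ (suc i) (s≤s i<j) = subst (λ t → z t ≢ 1) (sym (+-suc a i)) (skipped i i<j)

module PartialSums (z : ℕ → ℕ) where

  partialSum : ℕ → ℕ
  partialSum m = blockSum z 0 m

  partialSum-≥ : ∀ m → z m ≡ 1 → m ≤ partialSum m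
  partialSum-≥ zero    _    = z≤n
  partialSum-≥ (suc m) zm≡1 rewrite blockSum-single-∈ z (suc m) zm≡1 = m≤n+m (suc m) (partialSum m)

  partialSum-mono : ∀ {m n} → m ≤ n → partialSum m ≤ partialSum n
  partialSum-mono = stepwise-mono partialSum (λ n → m≤m+n (partialSum n) _)

  partialSum-increment∈AFS : ∀ {m m′ s} → m < m′ → z m′ ≡ 1 → partialSum m′ ≡ partialSum m + s → s ∈AFS z
  partialSum-increment∈AFS {m} {m′} {s} m<m′ zm′≡1 increment = fromNext (nextMember z (suc m) r z[1+m+r]≡1)
    where
    r : ℕ
    r = m′ ∸ suc m
    m′≡1+m+r : suc (m + r) ≡ m′
    m′≡1+m+r = m+[n∸m]≡n m<m′
    z[1+m+r]≡1 : z (suc m + r) ≡ 1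
    z[1+m+r]≡1 = subst (λ t → z t ≡ 1) (sym m′≡1+m+r) zm′≡1
    fromNext : ∃[ j ] (j ≤ r × z (suc m + j) ≡ 1 × ∀ i → i < j → z (suc m + i) ≢ 1) → s ∈AFS z
    fromNext (j , j≤r , z[1+m+j]≡1 , skipped) = suc m + j , r ∸ j , z[1+m+j]≡1 , end∈ , sym (+-cancelˡ-≡ (partialSum m) _ _ sums)
      where
      r≡j+[r∸j] : r ≡ j + (r ∸ j)
      r≡j+[r∸j] = sym (m+[n∸m]≡n j≤r)
      end∈ : z (suc m + j + (r ∸ j)) ≡ 1
      end∈ = subst (λ t → z t ≡ 1) (trans (cong (suc m +_) r≡j+[r∸j]) (sym (+-assoc (suc m) j (r ∸ j)))) z[1+m+r]≡1
      open ≡-Reasoning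
      sums : partialSum m + blockSum z (suc m + j) (r ∸ j) ≡ partialSum m + s
      sums = begin
          partialSum m + blockSum z (suc m + j) (r ∸ j)
        ≡⟨ cong (partialSum m +_) (sym (blockSum-skip z (suc m) j (r ∸ j) skipped)) ⟩
          partialSum m + blockSum z (suc m) (j + (r ∸ j))
        ≡⟨ cong (λ t → partialSum m + blockSum z (suc m) t) (sym r≡j+[r∸j]) ⟩
          partialSum m + blockSum z (suc m) r
        ≡⟨ sym (blockSum-split z 0 m r) ⟩
          partialSum (suc (m + r))
        ≡⟨ cong partialSum m′≡1+m+r ⟩
          partialSum m′
        ≡⟨ increment ⟩
          partialSum m + s
        ∎

  partialSumAt : ℕ → ℕ → ℕ
  partialSumAt j n = eqInd (z j) 1 * eqInd (partialSum j) n

  partialSumSet : ℕ → ℕ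
  partialSumSet = existsUpTo partialSumAt

  partialSum∈partialSumSet : ∀ m → z m ≡ 1 → partialSum m ∈S partialSumSet
  partialSum∈partialSumSet m zm≡1 =
    existsUpTo-intro partialSumAt (partialSum m) m (partialSum-≥ m zm≡1) (subst (λ t → eqInd t 1 * eqInd (partialSum m) (partialSum m) ≢ 0) (sym zm≡1) product≢0)
    where
    product≢0 : eqInd 1 1 * eqInd (partialSum m) (partialSum m) ≢ 0
    product≢0 rewrite eqInd-refl (partialSum m) = λ ()

  partialSumSet-elim : ∀ n → n ∈S partialSumSet → ∃[ m ] (z m ≡ 1 × partialSum m ≡ n)
  partialSumSet-elim n n∈ with existsUpTo-elim partialSumAt n n∈
  ... | m , _ , product≢0 with eqInd (z m) 1 in e₁ | eqInd (partialSum m) n in e₂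
  ...   | zero  | _     = ⊥-elim (product≢0 refl)
  ...   | suc q | zero  = ⊥-elim (product≢0 (*-zeroʳ (suc q)))
  ...   | suc _ | suc _ = m , eqInd≢0⇒≡ _ _ (λ e → 0≢1+n (trans (sym e) e₁)) , eqInd≢0⇒≡ _ _ (λ e → 0≢1+n (trans (sym e) e₂))

  partialSumSet-infinite : Infinite z → Infinite partialSumSet
  partialSumSet-infinite infinite n with infinite n
  ... | m , n≤m , zm≡1 = partialSum m , ≤-trans n≤m (partialSum-≥ m zm≡1) , partialSum∈partialSumSet m zm≡1

  partialSumSet-difference∈AFS : ∀ a d → a ∈S partialSumSet → (a + suc d) ∈S partialSumSet → suc d ∈AFS z
  partialSumSet-difference∈AFS a d a∈ b∈ with partialSumSet-elim a a∈ | partialSumSet-elim (a + suc d) b∈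
  ... | m , _ , Sm≡a | m′ , zm′≡1 , Sm′≡b = partialSum-increment∈AFS m<m′ zm′≡1 (trans Sm′≡b (cong (_+ suc d) (sym Sm≡a)))
    where
    m<m′ : m < m′
    m<m′ with m′ ≤? m
    ... | no  m′≰m = ≰⇒> m′≰m
    ... | yes m′≤m = ⊥-elim (<⇒≱ (subst₂ _<_ (sym Sm≡a) (sym Sm′≡b) (m<m+n a (s≤s z≤n))) (partialSum-mono m′≤m))

partialSumC : Code 1
partialSumC = recC zeroC (app₂ addC π₁ (app₂ mulC (app₂ eqC (app₁ oracC (app₁ succC π₀)) oneC) (app₁ succC π₀)))

partialSumSetC : Code 1
partialSumSetC = existsUpToC (app₂ mulC (app₂ eqC (app₁ oracC π₀) oneC) (app₂ eqC (app₁ partialSumC π₀) π₁))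

partialSumSetᴿ : ∀ {z} → Realises z partialSumSetC (λ v → PartialSums.partialSumSet z (arg₀ v))
partialSumSetᴿ {z} = existsUpToᴿ {P = PartialSums.partialSumAt z} (app₂ᴿ mulᴿ (app₂ᴿ eqᴿ (app₁ᴿ oracleᴿ π₀ᴿ) oneᴿ) (app₂ᴿ eqᴿ (app₁ᴿ partialSumᴿ π₀ᴿ) π₁ᴿ))
  where
  partialSumᴿ : Realises z partialSumC (λ v → PartialSums.partialSum z (arg₀ v))
  partialSumᴿ = recᴿ zeroᴿ (app₂ᴿ addᴿ π₁ᴿ (app₂ᴿ mulᴿ (app₂ᴿ eqᴿ (app₁ᴿ oracleᴿ (app₁ᴿ succᴿ π₀ᴿ)) oneᴿ) (app₁ᴿ succᴿ π₀ᴿ))) _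
    (λ { [] → trans (blockSum-single-eqInd z 0) (*-zeroʳ (eqInd (z 0) 1)) })
    (λ { x [] → cong (blockSum z 0 x +_) (blockSum-single-eqInd z (suc x)) })

ZRT2≤sWAHT : ZRT2 ≤sW AHT
ZRT2≤sWAHT = colourFromZeroC , partialSumSetC , λ x (bounded , invariant) →
  colourFromZero x , realises⇒computes colourFromZeroᴿ , (λ n → bounded 0 (pred n)) ,
  λ z (_ , infinite , i , homogeneous) → let open PartialSums z in
    partialSumSet , realises⇒computes partialSumSetᴿ , existsUpTo≤1 _ , partialSumSet-infinite infinite , i ,
    λ a d a∈ b∈ → trans (sym (invariant 0 d a)) (homogeneous (suc d) (partialSumSet-difference∈AFS a d a∈ b∈))

-- AHT reduces to ℤ-RT²

tri-mono : ∀ {m n} → m ≤ n → tri m ≤ tri n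
tri-mono = stepwise-mono tri (λ n → m≤n+m (tri n) (suc n))

diagonalBound : ℕ → ℕ → ℕ
diagonalBound p i = suc p ∸ tri (suc i)

diagonalBound-total : ∀ p → diagonalBound p p ≡ 0
diagonalBound-total p = m≤n⇒m∸n≡0 (m≤m+n (suc p) (tri p))

diagonal : ℕ → ℕ
diagonal p = proj₁ (leastZero (diagonalBound p) p (diagonalBound-total p))

diagonal-least : ∀ p → IsLeastZero (diagonalBound p) (diagonal p)
diagonal-least p = proj₂ (leastZero (diagonalBound p) p (diagonalBound-total p))

diagonal-pair : ∀ a d → diagonal (pair a d) ≡ a + d
diagonal-pair a d = IsLeastZero-unique (diagonal-least (pair a d)) (bounded , below)
  where
  pair<tri[1+a+d] : pair a d < tri (suc (a + d))
  pair<tri[1+a+d] = s≤s (subst (tri (a + d) + d ≤_) (+-comm (tri (a + d)) (a + d)) (+-monoʳ-≤ (tri (a + d)) (m≤n+m d a)))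
  bounded : diagonalBound (pair a d) (a + d) ≡ 0
  bounded = m≤n⇒m∸n≡0 pair<tri[1+a+d]
  below : ∀ m → m < a + d → diagonalBound (pair a d) m ≢ 0
  below m m<a+d e = <-irrefl refl (≤-trans (m∸n≡0⇒m≤n e) (≤-trans (tri-mono m<a+d) (m≤m+n (tri (a + d)) d)))

pairSnd : ℕ → ℕ
pairSnd p = p ∸ tri (diagonal p)

pairSnd-pair : ∀ a d → pairSnd (pair a d) ≡ d
pairSnd-pair a d rewrite diagonal-pair a d = m+n∸m≡n (tri (a + d)) d

diagonalC : Code 1
diagonalC = muC (app₂ monusC (app₁ triC (app₁ succC π₀)) (app₁ succC π₁))

diagonalᴿ : ∀ {α} → Realises α diagonalC (λ v → diagonal (arg₀ v))
diagonalᴿ = muᴿ (app₂ᴿ monusᴿ (app₁ᴿ triᴿ (app₁ᴿ succᴿ π₀ᴿ)) (app₁ᴿ succᴿ π₁ᴿ)) (λ v → diagonal (arg₀ v))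
              (λ { (p ∷ []) → diagonal-least p })

pairSndC : Code 1
pairSndC = app₂ monusC (app₁ triC diagonalC) π₀

pairSndᴿ : ∀ {α} → Realises α pairSndC (λ v → pairSnd (arg₀ v))
pairSndᴿ = app₂ᴿ monusᴿ (app₁ᴿ triᴿ diagonalᴿ) π₀ᴿ

differenceColouring : (ℕ → ℕ) → ℕ → ℕ
differenceColouring x zero    = x 0
differenceColouring x (suc p) = col x (suc (pairSnd p))

differenceColouring-pair : ∀ x a d → colPair (differenceColouring x) a d ≡ col x (suc d)
differenceColouring-pair x a d = cong (λ e → col x (suc e)) (pairSnd-pair a d)

differenceColouring-homogeneous : ∀ x (z : ℕ → ℕ) i →
  (∀ a d → a ∈S z → (a + suc d) ∈S z → colPair (differenceColouring x) a d ≡ i) →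
  ∀ s → ∃[ u ] ∃[ d ] (u ∈S z × (u + suc d) ∈S z × s ≡ suc d) → col x s ≡ i
differenceColouring-homogeneous x z i homogeneous s (u , d , u∈ , v∈ , refl) =
  trans (sym (differenceColouring-pair x u d)) (homogeneous u d u∈ v∈)

differenceColouringC : Code 1
differenceColouringC = recC (app₁ oracC zeroC) (app₁ oracC (app₁ succC (app₁ succC (app₁ pairSndC π₀))))

differenceColouringᴿ : ∀ {x} → Realises x differenceColouringC (λ v → differenceColouring x (arg₀ v))
differenceColouringᴿ = recᴿ (app₁ᴿ oracleᴿ zeroᴿ) (app₁ᴿ oracleᴿ (app₁ᴿ succᴿ (app₁ᴿ succᴿ (app₁ᴿ pairSndᴿ π₀ᴿ)))) _
  (λ { [] → refl }) (λ { x [] → refl })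

nextC : Code 1
nextC = muC (app₂ addC (app₂ monusC π₀ π₁) (app₂ monusC (app₁ oracC π₀) oneC))

anchorC : Code 1
anchorC = recC (app₁ nextC zeroC) (app₁ nextC (app₁ succC (app₂ addC π₁ π₁)))

gapC : Code 1
gapC = app₂ monusC (app₁ anchorC π₀) (app₁ anchorC (app₁ succC π₀))

gapSetC : Code 1
gapSetC = existsUpToC (app₂ eqC (app₁ gapC π₀) π₁)

module Anchors (z : ℕ → ℕ) (z≤1 : IsSetName z) (infinite : Infinite z) where

  nextDistance : ℕ → ℕ → ℕ
  nextDistance n m = (n ∸ m) + (1 ∸ z m)

  nextDistance-total : ∀ n → ∃[ m ] nextDistance n m ≡ 0
  nextDistance-total n with infinite n
  ... | m , n≤m , zm≡1 = m , cong₂ _+_ (m≤n⇒m∸n≡0 n≤m) (cong (1 ∸_) zm≡1)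

  next : ℕ → ℕ
  next n = proj₁ (leastZero (nextDistance n) _ (proj₂ (nextDistance-total n)))

  next-least : ∀ n → IsLeastZero (nextDistance n) (next n)
  next-least n = proj₂ (leastZero (nextDistance n) _ (proj₂ (nextDistance-total n)))

  next-≥ : ∀ n → n ≤ next n
  next-≥ n = m∸n≡0⇒m≤n (m+n≡0⇒m≡0 _ (proj₁ (next-least n)))

  next-∈ : ∀ n → next n ∈S z
  next-∈ n = ≤-antisym (z≤1 (next n)) (m∸n≡0⇒m≤n (m+n≡0⇒n≡0 (n ∸ next n) (proj₁ (next-least n))))

  anchor : ℕ → ℕ
  anchor zero    = next 0
  anchor (suc k) = next (suc (anchor k + anchor k))

  anchor-∈ : ∀ k → anchor k ∈S z
  anchor-∈ zero    = next-∈ 0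
  anchor-∈ (suc k) = next-∈ _

  anchor-step : ∀ k → anchor k < anchor (suc k)
  anchor-step k = ≤-trans (s≤s (m≤m+n (anchor k) (anchor k))) (next-≥ _)

  gap : ℕ → ℕ
  gap k = anchor (suc k) ∸ anchor k

  anchor<gap : ∀ k → anchor k < gap k
  anchor<gap k = m+n≤o⇒m≤o∸n (suc (anchor k)) {anchor k} (next-≥ _)

  gap-step : ∀ k → gap k < gap (suc k)
  gap-step k = ≤-<-trans (m∸n≤m (anchor (suc k)) (anchor k)) (anchor<gap (suc k))

  gap-≥ : ∀ k → k ≤ gap k
  gap-≥ zero    = z≤n
  gap-≥ (suc k) = ≤-<-trans (gap-≥ k) (gap-step k)

  gapAt : ℕ → ℕ → ℕ
  gapAt k v = eqInd (gap k) v

  gapSet : ℕ → ℕ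
  gapSet = existsUpTo gapAt

  gapSet-∈ : ∀ k → gap k ∈S gapSet
  gapSet-∈ k = existsUpTo-intro gapAt (gap k) k (gap-≥ k) (subst (_≢ 0) (sym (eqInd-refl (gap k))) λ ())

  gapSet-elim : ∀ v → v ∈S gapSet → ∃[ k ] gap k ≡ v
  gapSet-elim v v∈ with existsUpTo-elim gapAt v v∈
  ... | k , _ , eq≢0 = k , eqInd≢0⇒≡ _ _ eq≢0

  gapSet-infinite : Infinite gapSet
  gapSet-infinite n = gap n , gap-≥ n , gapSet-∈ n

  AFS⇒anchorDifference : ∀ s → s ∈AFS gapSet → ∃[ u ] ∃[ d ] (u ∈S z × (u + suc d) ∈S z × s ≡ suc d)
  AFS⇒anchorDifference s s∈ with EnumeratedSet.AFS⇒sumFrom gap gap-step gapSet gapSet-∈ gapSet-elim s s∈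
  ... | n , q , s≡ = anchor n , d , anchor-∈ n , subst (_∈S z) (sym u+1+d≡) (anchor-∈ (suc (n + q))) , s≡1+d
    where
    u<v : anchor n < anchor (suc (n + q))
    u<v = StrictlyIncreasing.mono-< anchor anchor-step (s≤s (m≤m+n n q))
    d : ℕ
    d = anchor (suc (n + q)) ∸ suc (anchor n)
    u+1+d≡ : anchor n + suc d ≡ anchor (suc (n + q))
    u+1+d≡ = trans (+-suc (anchor n) d) (m+[n∸m]≡n u<v)
    s≡1+d : s ≡ suc d
    s≡1+d = trans s≡ (trans (sumFrom-differences anchor (λ k → <⇒≤ (anchor-step k)) n q)
                            (trans (cong (_∸ anchor n) (sym u+1+d≡)) (m+n∸m≡n (anchor n) (suc d))))

  gapSetᴿ : Realises z gapSetC (λ v → gapSet (arg₀ v))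
  gapSetᴿ = existsUpToᴿ {P = gapAt} (app₂ᴿ eqᴿ (app₁ᴿ gapᴿ π₀ᴿ) π₁ᴿ)
    where
    nextᴿ : Realises z nextC (λ v → next (arg₀ v))
    nextᴿ = muᴿ (app₂ᴿ addᴿ (app₂ᴿ monusᴿ π₀ᴿ π₁ᴿ) (app₂ᴿ monusᴿ (app₁ᴿ oracleᴿ π₀ᴿ) oneᴿ)) (λ v → next (arg₀ v))
                (λ { (n ∷ []) → next-least n })
    anchorᴿ : Realises z anchorC (λ v → anchor (arg₀ v))
    anchorᴿ = recᴿ (app₁ᴿ nextᴿ zeroᴿ) (app₁ᴿ nextᴿ (app₁ᴿ succᴿ (app₂ᴿ addᴿ π₁ᴿ π₁ᴿ))) _
                (λ { [] → refl }) (λ { x [] → refl })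
    gapᴿ : Realises z gapC (λ v → gap (arg₀ v))
    gapᴿ = app₂ᴿ monusᴿ (app₁ᴿ anchorᴿ π₀ᴿ) (app₁ᴿ anchorᴿ (app₁ᴿ succᴿ π₀ᴿ))

AHT≤sWZRT2 : AHT ≤sW ZRT2
AHT≤sWZRT2 = differenceColouringC , gapSetC , λ x bounded →
  differenceColouring x , realises⇒computes differenceColouringᴿ ,
  ((λ a d → subst (_< x 0) (sym (differenceColouring-pair x a d)) (bounded (suc d))) ,
   (λ a d k → trans (differenceColouring-pair x a d) (sym (differenceColouring-pair x (a + k) d)))) ,
  λ z (z≤1 , infinite , i , homogeneous) → let open Anchors z z≤1 infinite in
    gapSet , realises⇒computes gapSetᴿ , existsUpTo≤1 gapAt , gapSet-infinite , i ,
    λ s s∈ → differenceColouring-homogeneous x z i homogeneous s (AFS⇒anchorDifference s s∈)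

mainTheorem3 : ZRT2 ≡sW AHT
mainTheorem3 = ZRT2≤sWAHT , AHT≤sWZRT2
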